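{- Let $v$ be a vertex of eligible tenacity. There is an $\mathrm{evenlevel}(v)$ path starting at the unmatched vertex $f$ if and only if there is an $\mathrm{oddlevel}(v)$ path starting at $f$.
   Context: $G=(V,E)$ is a finite undirected graph and $M$ a matching; edges in $M$ are matched, others unmatched; a vertex is unmatched if no matched edge is incident to it. An alternating path is a simple path alternating between matched and unmatched edges; an augmenting path is an alternating path between two distinct unmatched vertices. $l_m$ is the length of a minimum length augmenting path ($\infty$ if none). $\mathrm{evenlevel}(v)$ ($\mathrm{oddlevel}(v)$) is the length of a minimum even (odd) length alternating path from some unmatched vertex to $v$ ($\infty$ if none); such a path is called an $\mathrm{evenlevel}(v)$ ($\mathrm{oddlevel}(v)$) path. Tenacity $\mathrm{t}(v)=\mathrm{evenlevel}(v)+\mathrm{oddlevel}(v)$; $t_m$ is the minimum tenacity of a vertex of $G$. An odd number $t$ is an eligible tenacity if $t_m\le t<l_m$; a vertex has eligible tenacity if its tenacity is eligible. -}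

module Defs where

open import Data.Nat using (ℕ; zero; suc; _+_; _≤_; _<_)
open import Data.Nat.Divisibility using (_∣_)
open import Data.Fin using (Fin)
open import Data.Bool using (Bool; true; false; not)
open import Data.List using (List; []; _∷_; length)
open import Data.List.Relation.Unary.Unique.Propositional using (Unique)
open import Data.Product using (Σ; _×_; ∃; ∃-syntax)
open import Data.Unit using (⊤)
open import Relation.Nullary using (¬_)
open import Relation.Binary.PropositionalEquality using (_≡_; _≢_)

Even : ℕ → Set
Even k = 2 ∣ k

Odd : ℕ → Set
Odd k = ¬ Even k

record Graph (n : ℕ) : Set where
  field
    E       : Fin n → Fin n → Bool
    E-sym   : ∀ u v → E u v ≡ E v u
    E-irrefl : ∀ v → E v v ≡ false
open Graph public

record Matching {n : ℕ} (G : Graph n) : Set where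
  field
    M      : Fin n → Fin n → Bool
    M⊆E    : ∀ u v → M u v ≡ true → E G u v ≡ true
    M-sym  : ∀ u v → M u v ≡ M v u
    M-uniq : ∀ u v w → M u v ≡ true → M u w ≡ true → v ≡ w
open Matching public

module _ {n : ℕ} (G : Graph n) (Mt : Matching G) where

  private
    V = Fin n

  Unmatched : V → Set
  Unmatched v = ∀ w → M Mt v w ≡ false

  Adjacent : List V → Set
  Adjacent (x ∷ y ∷ r) = (E G x y ≡ true) × Adjacent (y ∷ r)
  Adjacent _ = ⊤

  Alternates : List V → Set
  Alternates (x ∷ y ∷ z ∷ r) = (M Mt x y ≡ not (M Mt y z)) × Alternates (y ∷ z ∷ r)
  Alternates _ = ⊤

  lastV : V → List V → V
  lastV a [] = a
  lastV a (x ∷ r) = lastV x r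

  AltPath : V → V → ℕ → Set
  AltPath a b k = Σ (List V) λ rest →
    Unique (a ∷ rest) × Adjacent (a ∷ rest) × Alternates (a ∷ rest)
    × lastV a rest ≡ b × length rest ≡ k

  EvenAltPathFrom : V → V → ℕ → Set
  EvenAltPathFrom f v k = Unmatched f × Even k × AltPath f v k

  OddAltPathFrom : V → V → ℕ → Set
  OddAltPathFrom f v k = Unmatched f × Odd k × AltPath f v k

  -- evenlevel(v) = k  (k finite): k is the minimum length of an even
  -- alternating path from some unmatched vertex to v.
  EvenLevel : V → ℕ → Set
  EvenLevel v k = (∃[ f ] EvenAltPathFrom f v k)
                × (∀ f k' → EvenAltPathFrom f v k' → k ≤ k')

  OddLevel : V → ℕ → Set
  OddLevel v k = (∃[ f ] OddAltPathFrom f v k)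
               × (∀ f k' → OddAltPathFrom f v k' → k ≤ k')

  Tenacity : V → ℕ → Set
  Tenacity v t = ∃[ e ] ∃[ o ] EvenLevel v e × OddLevel v o × t ≡ e + o

  MinTenacity : ℕ → Set
  MinTenacity tm = (∃[ u ] Tenacity u tm) × (∀ u t → Tenacity u t → tm ≤ t)

  AugPath : ℕ → Set
  AugPath k = ∃[ a ] ∃[ b ] (a ≢ b) × Unmatched a × Unmatched b × AltPath a b k

  -- t < l_m  (l_m the minimum augmenting path length, possibly ∞)
  BelowLm : ℕ → Set
  BelowLm t = ∀ k → AugPath k → t < k

  EligibleTenacity : ℕ → Set
  EligibleTenacity t = Odd t × (∃[ tm ] MinTenacity tm × tm ≤ t) × BelowLm t

-- Let P, from f, and Q, from another unmatched vertex g, be alternating paths to v realising the two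
-- levels of v, of lengths p and q. Cut P at its first vertex x on Q. If the parts of P and Q before x
-- have lengths of opposite parity they form an augmenting path from f to g of length at most p + q < l_m,
-- which is impossible. Otherwise P up to x followed by Q after x is an alternating path from f of the
-- parity of q, so by minimality of q the part of P before x is at least as long as that of Q. The
-- same holds with P and Q exchanged, at the first vertex y of Q on P; as x comes no later than y on
-- P and y no later than x on Q, all four parts have the same length, and the rerouted path from f
-- has length exactly q.
--
-- A list cut at x is written xs ʳ++ x ∷ ys, so that x ∷ xs is the ray from x back to the start.

module Submission where

open import Defs
open import Data.Nat using (ℕ; zero; suc; _+_; _*_; _≤_; _<_; z≤n; s≤s)
open import Data.Nat.Properties
  using (+-suc; +-comm; ≤-antisym; module ≤-Reasoning; +-cancelʳ-≤; m≤m+n; +-mono-≤; <⇒≱;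
         suc-injective)
open import Data.Nat.Divisibility using (divides)
open import Data.Fin using (Fin) renaming (_≟_ to _≟ᶠ_)
open import Data.Bool using (Bool; false; not; _xor_)
open import Data.Bool.Properties
  using (not-involutive; not-distribˡ-xor; not-distribʳ-xor; xor-same; ¬-not)
  renaming (_≟_ to _≟ᵇ_)
open import Data.List using (List; []; _∷_; length; _++_; reverse; _ʳ++_)
open import Data.List.Properties using (length-reverse; ʳ++-defn; length-ʳ++; ∷-injective)
open import Data.List.Membership.Propositional using (_∈_; _∉_; lose)
open import Data.List.Relation.Unary.Any using (Any; here; there)
open import Data.List.Relation.Unary.Any.Properties using (reverseAcc⁺; reverse⁻)
open import Data.List.Relation.Unary.All.Properties using (¬Any⇒All¬; All¬⇒¬Any)
open import Data.List.Relation.Unary.AllPairs using ([]; _∷_)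
open import Data.List.Relation.Unary.Unique.Propositional using (Unique)
open import Data.List.Relation.Binary.Disjoint.Propositional using (Disjoint)
open import Data.Product using (_×_; _,_; ∃-syntax; proj₁; proj₂)
open import Data.Sum using (inj₁; inj₂)
open import Data.Empty using (⊥-elim)
open import Data.Unit using (⊤; tt)
open import Relation.Nullary using (yes; no)
open import Relation.Binary.Definitions using (DecidableEquality)
open import Relation.Binary.PropositionalEquality
open import Function using (_∘_)
open import Function.Bundles using (_⇔_; mk⇔)

xor-not-swap : ∀ p b → not p xor b ≡ p xor not b
xor-not-swap p b = trans (sym (not-distribˡ-xor p b)) (not-distribʳ-xor p b)

isOdd : ℕ → Bool
isOdd zero    = false
isOdd (suc n) = not (isOdd n)

isOdd-+ : ∀ m n → isOdd (m + n) ≡ isOdd m xor isOdd n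
isOdd-+ zero    n = refl
isOdd-+ (suc m) n = trans (cong not (isOdd-+ m n)) (not-distribˡ-xor (isOdd m) (isOdd n))

Even⇒isOdd≡false : ∀ {k} → Even k → isOdd k ≡ false
Even⇒isOdd≡false (divides q refl) = isOdd-*2 q
  where
  isOdd-*2 : ∀ q → isOdd (q * 2) ≡ false
  isOdd-*2 zero    = refl
  isOdd-*2 (suc q) = trans (not-involutive _) (isOdd-*2 q)

isOdd≡false⇒Even : ∀ k → isOdd k ≡ false → Even k
isOdd≡false⇒Even zero          _ = divides 0 refl
isOdd≡false⇒Even (suc (suc k)) h with isOdd≡false⇒Even k (trans (sym (not-involutive _)) h)
... | divides q eq = divides (suc q) (cong (suc ∘ suc) eq)

Even-resp-isOdd : ∀ {m n} → isOdd m ≡ isOdd n → Even m → Even n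
Even-resp-isOdd {n = n} eq em = isOdd≡false⇒Even n (trans (sym eq) (Even⇒isOdd≡false em))

Odd-resp-isOdd : ∀ {m n} → isOdd m ≡ isOdd n → Odd m → Odd n
Odd-resp-isOdd eq om en = om (Even-resp-isOdd (sym eq) en)

module _ {A : Set} where

  Unique-ʳ++⁺ : ∀ xs {ys : List A} → Unique xs → Unique ys → Disjoint xs ys → Unique (xs ʳ++ ys)
  Unique-ʳ++⁺ []       _            uys _    = uys
  Unique-ʳ++⁺ (x ∷ xs) (x∉xs ∷ uxs) uys disj =
    Unique-ʳ++⁺ xs uxs (¬Any⇒All¬ _ (λ x∈ys → disj (here refl , x∈ys)) ∷ uys) disj′
    where
    disj′ : Disjoint xs (x ∷ _)
    disj′ (z∈xs , here refl) = All¬⇒¬Any x∉xs z∈xs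
    disj′ (z∈xs , there z∈ys) = disj (there z∈xs , z∈ys)

  Unique-ʳ++⁻ : ∀ xs {ys : List A} → Unique (xs ʳ++ ys) → Unique xs × Unique ys × Disjoint xs ys
  Unique-ʳ++⁻ []       u = [] , u , λ ()
  Unique-ʳ++⁻ (x ∷ xs) u with Unique-ʳ++⁻ xs u
  ... | uxs , x∉ys ∷ uys , disj =
    ¬Any⇒All¬ xs (λ x∈xs → disj (x∈xs , here refl)) ∷ uxs , uys , disj′
    where
    disj′ : Disjoint (x ∷ xs) _
    disj′ (here refl , z∈ys) = All¬⇒¬Any x∉ys z∈ys
    disj′ (there z∈xs , z∈ys) = disj (z∈xs , there z∈ys)

  ∈-ʳ++⁺ˡ : ∀ {z : A} xs {ys} → z ∈ xs → z ∈ xs ʳ++ ys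
  ∈-ʳ++⁺ˡ xs {ys} z∈xs = reverseAcc⁺ ys xs (inj₂ z∈xs)

  ∈-ʳ++⁺ʳ : ∀ {z : A} xs {ys} → z ∈ ys → z ∈ xs ʳ++ ys
  ∈-ʳ++⁺ʳ xs {ys} z∈ys = reverseAcc⁺ ys xs (inj₁ z∈ys)

  ∈-ʳ++⁺-∷ : ∀ {z x : A} xs {ys} → z ∈ x ∷ xs → z ∈ xs ʳ++ x ∷ ys
  ∈-ʳ++⁺-∷ xs (here refl)  = ∈-ʳ++⁺ʳ xs (here refl)
  ∈-ʳ++⁺-∷ xs (there z∈xs) = ∈-ʳ++⁺ˡ xs z∈xs

  ∈⇒cut : ∀ {x : A} xs {ys} → x ∈ ys → ∃[ us ] ∃[ ws ] xs ʳ++ ys ≡ us ʳ++ x ∷ ws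
  ∈⇒cut xs {_ ∷ ws} (here refl) = xs , ws , refl
  ∈⇒cut xs {y ∷ _}  (there x∈ys) = ∈⇒cut (y ∷ xs) x∈ys

  ++-∷-position : ∀ {x y : A} us vs us′ vs′ → us ++ x ∷ vs ≡ us′ ++ y ∷ vs′ → y ∉ us
                → length us ≤ length us′
  ++-∷-position []       _  _         _  _  _   = z≤n
  ++-∷-position (u ∷ us) _  []        _  eq y∉ = ⊥-elim (y∉ (here (sym (proj₁ (∷-injective eq)))))
  ++-∷-position (u ∷ us) vs (_ ∷ us′) vs′ eq y∉ =
    s≤s (++-∷-position us vs us′ vs′ (proj₂ (∷-injective eq)) (y∉ ∘ there))

  ʳ++-∷-position : ∀ {x y : A} xs ys xs′ ys′ → xs ʳ++ x ∷ ys ≡ xs′ ʳ++ y ∷ ys′ → y ∉ xs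
                 → length xs ≤ length xs′
  ʳ++-∷-position xs ys xs′ ys′ eq y∉ =
    subst₂ _≤_ (length-reverse xs) (length-reverse xs′)
      (++-∷-position (reverse xs) ys (reverse xs′) ys′
        (trans (sym (ʳ++-defn xs)) (trans eq (ʳ++-defn xs′))) (y∉ ∘ reverse⁻))

module _ {A : Set} (_≟_ : DecidableEquality A) where
  open import Data.List.Membership.DecPropositional _≟_ using (_∈?_)

  firstCut : ∀ (Q : List A) xs x ys → Disjoint xs Q → Any (_∈ Q) (x ∷ ys)
           → ∃[ xs′ ] ∃[ x′ ] ∃[ ys′ ] (xs ʳ++ x ∷ ys ≡ xs′ ʳ++ x′ ∷ ys′) × x′ ∈ Q × Disjoint xs′ Q
  firstCut Q xs x ys disj common with x ∈? Q
  ... | yes x∈Q = xs , x , ys , refl , x∈Q , disj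
  firstCut Q xs x ys       disj (here x∈Q)     | no x∉Q = ⊥-elim (x∉Q x∈Q)
  firstCut Q xs x (y ∷ ys) disj (there common) | no x∉Q = firstCut Q (x ∷ xs) y ys disj′ common
    where
    disj′ : Disjoint (x ∷ xs) Q
    disj′ (here refl , x∈Q)  = x∉Q x∈Q
    disj′ (there z∈xs , z∈Q) = disj (z∈xs , z∈Q)

module _ {n : ℕ} (G : Graph n) (Mt : Matching G) where

  private
    V = Fin n

  AltFrom : Bool → List V → Set
  AltFrom b (x ∷ y ∷ r) = M Mt x y ≡ b × AltFrom (not b) (y ∷ r)
  AltFrom _ _           = ⊤

  AltRay : Bool → List V → Set
  AltRay b L = Unique L × Adjacent G Mt L × AltFrom b L

  Alternates⇒AltFrom : ∀ x y r → Alternates G Mt (x ∷ y ∷ r) → AltFrom (M Mt x y) (x ∷ y ∷ r)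
  Alternates⇒AltFrom x y []      _            = refl , tt
  Alternates⇒AltFrom x y (z ∷ r) (xy≡¬yz , alt) =
    refl , subst (λ b → AltFrom b (y ∷ z ∷ r))
                 (trans (sym (not-involutive _)) (cong not (sym xy≡¬yz)))
                 (Alternates⇒AltFrom y z r alt)

  AltFrom⇒Alternates : ∀ b L → AltFrom b L → Alternates G Mt L
  AltFrom⇒Alternates b []              _                = tt
  AltFrom⇒Alternates b (_ ∷ [])        _                = tt
  AltFrom⇒Alternates b (_ ∷ _ ∷ [])    _                = tt
  AltFrom⇒Alternates b (x ∷ y ∷ z ∷ r) (xy≡b , yz≡¬b , alt) =
    trans xy≡b (trans (sym (not-involutive b)) (cong not (sym yz≡¬b))) ,
    AltFrom⇒Alternates (not b) (y ∷ z ∷ r) (yz≡¬b , alt)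

  AltPath⇒AltRay : ∀ {a b k} → Unmatched G Mt a → (p : AltPath G Mt a b k)
                 → AltRay false (a ∷ proj₁ p)
  AltPath⇒AltRay     ua ([]    , u , adj , _)   = u , adj , tt
  AltPath⇒AltRay {a} ua (y ∷ r , u , adj , alt , _) =
    u , adj , subst (λ b → AltFrom b (a ∷ y ∷ r)) (ua y) (Alternates⇒AltFrom a y r alt)

  Adjacent-ʳ++⁺ : ∀ xs x ys → Adjacent G Mt (x ∷ xs) → Adjacent G Mt (x ∷ ys)
                → Adjacent G Mt (xs ʳ++ x ∷ ys)
  Adjacent-ʳ++⁺ []       x ys _           adj = adj
  Adjacent-ʳ++⁺ (y ∷ xs) x ys (xy , adjxs) adj =
    Adjacent-ʳ++⁺ xs y (x ∷ ys) adjxs (trans (E-sym G y x) xy , adj)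

  Adjacent-ʳ++⁻ : ∀ xs x ys → Adjacent G Mt (xs ʳ++ x ∷ ys)
                → Adjacent G Mt (x ∷ xs) × Adjacent G Mt (x ∷ ys)
  Adjacent-ʳ++⁻ []       x ys adj = tt , adj
  Adjacent-ʳ++⁻ (y ∷ xs) x ys adj with Adjacent-ʳ++⁻ xs y (x ∷ ys) adj
  ... | adjxs , yx , adjys = (trans (E-sym G x y) yx , adjxs) , adjys

  AltFrom-ʳ++⁺ : ∀ b xs x ys → AltFrom (not b) (x ∷ xs) → AltFrom b (x ∷ ys)
               → AltFrom (isOdd (length xs) xor b) (xs ʳ++ x ∷ ys)
  AltFrom-ʳ++⁺ b []       x ys _             alt = alt
  AltFrom-ʳ++⁺ b (y ∷ xs) x ys (xy≡¬b , altxs) alt =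
    subst (λ c → AltFrom c (xs ʳ++ y ∷ x ∷ ys)) (sym (xor-not-swap (isOdd (length xs)) b))
      (AltFrom-ʳ++⁺ (not b) xs y (x ∷ ys) altxs
        (trans (M-sym Mt y x) xy≡¬b , subst (λ c → AltFrom c (x ∷ ys)) (sym (not-involutive b)) alt))

  AltFrom-ʳ++⁻ : ∀ b xs x ys → AltFrom (isOdd (length xs) xor b) (xs ʳ++ x ∷ ys)
               → AltFrom (not b) (x ∷ xs) × AltFrom b (x ∷ ys)
  AltFrom-ʳ++⁻ b []       x ys alt = tt , alt
  AltFrom-ʳ++⁻ b (y ∷ xs) x ys alt
    with AltFrom-ʳ++⁻ (not b) xs y (x ∷ ys)
           (subst (λ c → AltFrom c (xs ʳ++ y ∷ x ∷ ys)) (xor-not-swap (isOdd (length xs)) b) alt)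
  ... | altxs , yx≡¬b , altys =
    (trans (M-sym Mt x y) yx≡¬b , altxs) , subst (λ c → AltFrom c (x ∷ ys)) (not-involutive b) altys

  AltRay-ʳ++⁺ : ∀ b xs x ys → AltRay (not b) (x ∷ xs) → AltRay b (x ∷ ys) → Disjoint xs (x ∷ ys)
              → AltRay (isOdd (length xs) xor b) (xs ʳ++ x ∷ ys)
  AltRay-ʳ++⁺ b xs x ys (_ ∷ uxs , adjxs , altxs) (uys , adjys , altys) disj =
    Unique-ʳ++⁺ xs uxs uys disj , Adjacent-ʳ++⁺ xs x ys adjxs adjys , AltFrom-ʳ++⁺ b xs x ys altxs altys

  AltRay-ʳ++⁻ : ∀ b xs x ys → AltRay (isOdd (length xs) xor b) (xs ʳ++ x ∷ ys)
              → AltRay (not b) (x ∷ xs) × AltRay b (x ∷ ys)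
  AltRay-ʳ++⁻ b xs x ys (u , adj , alt)
    with Unique-ʳ++⁻ xs u | Adjacent-ʳ++⁻ xs x ys adj | AltFrom-ʳ++⁻ b xs x ys alt
  ... | uxs , uys , disj | adjxs , adjys | altxs , altys =
    (¬Any⇒All¬ xs (λ x∈xs → disj (x∈xs , here refl)) ∷ uxs , adjxs , altxs) , (uys , adjys , altys)

  reroute : ∀ xs x ys zs → AltRay false (xs ʳ++ x ∷ ys) → AltRay (isOdd (length xs)) (x ∷ zs)
          → Disjoint xs (x ∷ zs) → AltRay false (xs ʳ++ x ∷ zs)
  reroute xs x ys zs ray rayzs disj =
    subst (λ c → AltRay c (xs ʳ++ x ∷ zs)) (xor-same p) (AltRay-ʳ++⁺ p xs x zs backRay rayzs disj)
    where
    p = isOdd (length xs)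
    backRay : AltRay (not p) (x ∷ xs)
    backRay = proj₁ (AltRay-ʳ++⁻ p xs x ys
                (subst (λ c → AltRay c (xs ʳ++ x ∷ ys)) (sym (xor-same p)) ray))

  AltRay⇒AltPath : ∀ xs x ys → AltRay false (xs ʳ++ x ∷ ys)
                 → AltPath G Mt (lastV G Mt x xs) (lastV G Mt x ys) (length xs + length ys)
  AltRay⇒AltPath []       x ys (u , adj , alt) = ys , u , adj , AltFrom⇒Alternates false _ alt , refl , refl
  AltRay⇒AltPath (y ∷ xs) x ys ray =
    subst (AltPath G Mt _ _) (+-suc (length xs) (length ys)) (AltRay⇒AltPath xs y (x ∷ ys) ray)

  lastV-∈ : ∀ a r → lastV G Mt a r ∈ a ∷ r
  lastV-∈ a []      = here refl
  lastV-∈ a (x ∷ r) = there (lastV-∈ x r)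

  cut-start : ∀ {a r} xs {x ys} → a ∷ r ≡ xs ʳ++ x ∷ ys → lastV G Mt x xs ≡ a
  cut-start []       refl = refl
  cut-start (_ ∷ xs) eq   = cut-start xs eq

  cut-end : ∀ {a r} xs {x ys} → a ∷ r ≡ xs ʳ++ x ∷ ys → lastV G Mt a r ≡ lastV G Mt x ys
  cut-end []       refl = refl
  cut-end (_ ∷ xs) eq   = cut-end xs eq

  cut-length : ∀ {a : V} {r} xs {x ys} → a ∷ r ≡ xs ʳ++ x ∷ ys → length r ≡ length xs + length ys
  cut-length xs {ys = ys} eq =
    suc-injective (trans (cong length eq) (trans (length-ʳ++ xs) (+-suc (length xs) (length ys))))

  record FirstMeeting (a : V) (rP : List V) (b : V) (rQ : List V) : Set where
    field
      xs ys us ws : List V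
      x           : V
      cutP        : a ∷ rP ≡ xs ʳ++ x ∷ ys
      cutQ        : b ∷ rQ ≡ us ʳ++ x ∷ ws
      beforeQ     : Disjoint xs (b ∷ rQ)

    x∈P : x ∈ a ∷ rP
    x∈P = subst (x ∈_) (sym cutP) (∈-ʳ++⁺ʳ xs (here refl))

    earliest : ∀ zs {z ts} → a ∷ rP ≡ zs ʳ++ z ∷ ts → z ∈ b ∷ rQ → length xs ≤ length zs
    earliest zs {ts = ts} cut z∈Q =
      ʳ++-∷-position xs ys zs ts (trans (sym cutP) cut) (λ z∈xs → beforeQ (z∈xs , z∈Q))

  firstMeeting : ∀ a rP b rQ → Any (_∈ b ∷ rQ) (a ∷ rP) → FirstMeeting a rP b rQ
  firstMeeting a rP b rQ common with firstCut _≟ᶠ_ (b ∷ rQ) [] a rP (λ { (() , _) }) common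
  ... | xs , x , ys , cutP , x∈Q , beforeQ with ∈⇒cut [] x∈Q
  ... | us , ws , cutQ = record
    { xs = xs ; ys = ys ; us = us ; ws = ws ; x = x ; cutP = cutP ; cutQ = cutQ ; beforeQ = beforeQ }

  module Meeting {a b rP rQ} (rayP : AltRay false (a ∷ rP)) (rayQ : AltRay false (b ∷ rQ))
                 (m : FirstMeeting a rP b rQ) where
    open FirstMeeting m

    private
      q = isOdd (length us)

      rayP-at-x : AltRay false (xs ʳ++ x ∷ ys)
      rayP-at-x = subst (AltRay false) cutP rayP

      raysQ-at-x : AltRay (not q) (x ∷ us) × AltRay q (x ∷ ws)
      raysQ-at-x = AltRay-ʳ++⁻ q us x ws
        (subst (λ c → AltRay c (us ʳ++ x ∷ ws)) (sym (xor-same q)) (subst (AltRay false) cutQ rayQ))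

      avoids : ∀ {zs} → (∀ {z} → z ∈ zs → z ∈ us ʳ++ x ∷ ws) → Disjoint xs zs
      avoids zs⊆Q (z∈xs , z∈zs) = beforeQ (z∈xs , subst (_ ∈_) (sym cutQ) (zs⊆Q z∈zs))

    detour : isOdd (length xs) ≡ q → AltPath G Mt a (lastV G Mt b rQ) (length xs + length ws)
    detour same = subst₂ (λ s t → AltPath G Mt s t _) (cut-start xs cutP) (sym (cut-end us cutQ))
      (AltRay⇒AltPath xs x ws
        (reroute xs x ys ws rayP-at-x (subst (λ c → AltRay c (x ∷ ws)) (sym same) (proj₂ raysQ-at-x))
                 (avoids (∈-ʳ++⁺ʳ us))))

    augmenting : a ≢ b → Unmatched G Mt a → Unmatched G Mt b → isOdd (length xs) ≢ q
               → AugPath G Mt (length xs + length us)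
    augmenting a≢b ua ub differ = a , b , a≢b , ua , ub ,
      subst₂ (λ s t → AltPath G Mt s t _) (cut-start xs cutP) (cut-start us cutQ)
        (AltRay⇒AltPath xs x us
          (reroute xs x ys us rayP-at-x
                   (subst (λ c → AltRay c (x ∷ us)) (sym (¬-not differ)) (proj₁ raysQ-at-x))
                   (avoids (∈-ʳ++⁺-∷ us))))

    backRay≤ : a ≢ b → Unmatched G Mt a → Unmatched G Mt b
             → (∀ k → AugPath G Mt k → length rP + length rQ < k)
             → (∀ k → isOdd k ≡ isOdd (length rQ) → AltPath G Mt a (lastV G Mt b rQ) k → length rQ ≤ k)
             → length us ≤ length xs
    backRay≤ a≢b ua ub below minQ with isOdd (length xs) ≟ᵇ q
    ... | no differ =
      ⊥-elim (<⇒≱ (below _ (augmenting a≢b ua ub differ)) (+-mono-≤ (prefix≤ xs cutP) (prefix≤ us cutQ)))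
      where
      prefix≤ : ∀ {c r} zs {z ts} → c ∷ r ≡ zs ʳ++ z ∷ ts → length zs ≤ length r
      prefix≤ zs cut = subst (length zs ≤_) (sym (cut-length zs cut)) (m≤m+n _ _)
    ... | yes same = +-cancelʳ-≤ (length ws) (length us) (length xs)
      (subst (_≤ length xs + length ws) (cut-length us cutQ) (minQ _ parity (detour same)))
      where
      parity : isOdd (length xs + length ws) ≡ isOdd (length rQ)
      parity = begin
        isOdd (length xs + length ws)           ≡⟨ isOdd-+ (length xs) (length ws) ⟩
        isOdd (length xs) xor isOdd (length ws) ≡⟨ cong (_xor isOdd (length ws)) same ⟩
        q xor isOdd (length ws)                 ≡⟨ isOdd-+ (length us) (length ws) ⟨
        isOdd (length us + length ws)           ≡⟨ cong isOdd (cut-length us cutQ) ⟨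
        isOdd (length rQ)                       ∎
        where open ≡-Reasoning

  otherParityPath : ∀ {a b v p q} → a ≢ b → Unmatched G Mt a → Unmatched G Mt b
                  → AltPath G Mt a v p → AltPath G Mt b v q
                  → (∀ k → AugPath G Mt k → p + q < k)
                  → (∀ k → isOdd k ≡ isOdd q → AltPath G Mt a v k → q ≤ k)
                  → (∀ k → isOdd k ≡ isOdd p → AltPath G Mt b v k → p ≤ k)
                  → AltPath G Mt a v q
  otherParityPath {a} {b} a≢b ua ub P@(rP , _ , _ , _ , endP , refl) Q@(rQ , _ , _ , _ , refl , refl)
                  below minQ minP =
    subst (AltPath G Mt a _) lengths (M.detour (cong isOdd xs≡us))
    where
    v∈P : lastV G Mt b rQ ∈ a ∷ rP
    v∈P = subst (_∈ a ∷ rP) endP (lastV-∈ a rP)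
    v∈Q = lastV-∈ b rQ

    rayP = AltPath⇒AltRay ua P
    rayQ = AltPath⇒AltRay ub Q
    m  = firstMeeting a rP b rQ (lose v∈P v∈Q)
    m′ = firstMeeting b rQ a rP (lose v∈Q v∈P)
    module M  = Meeting rayP rayQ m
    module M′ = Meeting rayQ rayP m′
    open FirstMeeting m
    module F′ = FirstMeeting m′

    xs≡us : length xs ≡ length us
    xs≡us = ≤-antisym xs≤us (M.backRay≤ a≢b ua ub below minQ)
      where
      belowQP : ∀ k → AugPath G Mt k → length rQ + length rP < k
      belowQP k aug = subst (_< k) (+-comm (length rP) (length rQ)) (below k aug)

      minP′ : ∀ k → isOdd k ≡ isOdd (length rP) → AltPath G Mt b (lastV G Mt a rP) k → length rP ≤ k
      minP′ k par path = minP k par (subst (λ t → AltPath G Mt b t k) endP path)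

      open ≤-Reasoning
      xs≤us : length xs ≤ length us
      xs≤us = begin
        length xs    ≤⟨ earliest F′.us F′.cutQ F′.x∈P ⟩
        length F′.us ≤⟨ M′.backRay≤ (a≢b ∘ sym) ub ua belowQP minP′ ⟩
        length F′.xs ≤⟨ F′.earliest us cutQ x∈P ⟩
        length us    ∎

    lengths : length xs + length ws ≡ length rQ
    lengths = trans (cong (_+ length ws) xs≡us) (sym (cut-length us cutQ))

lemma6p2 : ∀ {n : ℕ} (G : Graph n) (Mt : Matching G) (v : Fin n) (e o : ℕ)
         → EvenLevel G Mt v e → OddLevel G Mt v o
         → EligibleTenacity G Mt (e + o)
         → (f : Fin n) → Unmatched G Mt f
         → (EvenAltPathFrom G Mt f v e ⇔ OddAltPathFrom G Mt f v o)
lemma6p2 G Mt v e o ((g₀ , ug₀ , even , P₀) , evenMin) ((g₁ , ug₁ , odd , Q₁) , oddMin) (_ , _ , below)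
         f uf = mk⇔ to from
  where
  minEven : ∀ {a} → Unmatched G Mt a → ∀ k → isOdd k ≡ isOdd e → AltPath G Mt a v k → e ≤ k
  minEven {a} ua k par path = evenMin a k (ua , Even-resp-isOdd (sym par) even , path)

  minOdd : ∀ {a} → Unmatched G Mt a → ∀ k → isOdd k ≡ isOdd o → AltPath G Mt a v k → o ≤ k
  minOdd {a} ua k par path = oddMin a k (ua , Odd-resp-isOdd (sym par) odd , path)

  to : EvenAltPathFrom G Mt f v e → OddAltPathFrom G Mt f v o
  to (_ , _ , P) with f ≟ᶠ g₁
  ... | yes refl = ug₁ , odd , Q₁
  ... | no f≢g₁  = uf , odd , otherParityPath G Mt f≢g₁ uf ug₁ P Q₁ below (minOdd uf) (minEven ug₁)

  from : OddAltPathFrom G Mt f v o → EvenAltPathFrom G Mt f v e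
  from (_ , _ , Q) with f ≟ᶠ g₀
  ... | yes refl = ug₀ , even , P₀
  ... | no f≢g₀  = uf , even , otherParityPath G Mt f≢g₀ uf ug₀ Q P₀
                                 (λ k aug → subst (_< k) (+-comm e o) (below k aug)) (minEven uf) (minOdd ug₀)
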